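{- Let $G$ be a strict-double-arborescence with root $r$, and consider its treelike (transitive) orientation. Then there exist two non-adjacent vertices $a_1,a_2$ of $G$ such that $\overrightarrow{ra_1}$ and $\overrightarrow{ra_2}$ are arcs of the orientation, and there exist two non-adjacent vertices $a_3,a_4$ of $G$ such that $\overrightarrow{a_3r}$ and $\overrightarrow{a_4r}$ are arcs of the orientation.
   Context: A graph is a comparability graph if it admits a transitive orientation. A treelike comparability graph is one admitting a transitive orientation (its treelike orientation, unique up to isomorphism and reversal of all arcs) whose Hasse diagram (transitive reduction), as an undirected graph, is a tree. A double-arborescence is a treelike comparability graph $G=(V,E)$ with a vertex $r$ (a root) such that $V=\{r\}\cup N_G(r)$. It is an arborescence if, under the treelike orientation, some root is a source (indegree zero) or a sink (outdegree zero). A strict-double-arborescence is a double-arborescence that is not an arborescence. -}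

module Defs where

open import Data.Nat using (ℕ; _≤_)
open import Data.Fin using (Fin)
open import Data.Bool using (Bool; T)
open import Data.List using (List; []; _∷_; _++_; length)
open import Data.List.Relation.Unary.Linked using (Linked)
open import Data.List.Relation.Unary.Unique.Propositional using (Unique)
open import Data.Product using (Σ; ∃; ∃-syntax; _×_)
open import Data.Sum using (_⊎_)
open import Relation.Nullary using (¬_)
open import Relation.Binary.PropositionalEquality using (_≡_; _≢_)
open import Relation.Binary.Construct.Closure.ReflexiveTransitive using (Star)

record Graph (n : ℕ) : Set where
  field
    adj       : Fin n → Fin n → Bool
    adj-sym   : ∀ u v → adj u v ≡ adj v u
    adj-irrefl : ∀ v → adj v v ≡ Data.Bool.false

open Graph public

Adj : ∀ {n} → Graph n → Fin n → Fin n → Set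
Adj G u v = T (adj G u v)

-- An orientation is given by a Bool-valued arc relation: arc u v = true means u → v.
Orientation : ℕ → Set
Orientation n = Fin n → Fin n → Bool

Arc : ∀ {n} → Orientation n → Fin n → Fin n → Set
Arc O u v = T (O u v)

IsOrientationOf : ∀ {n} → Graph n → Orientation n → Set
IsOrientationOf {n} G O =
  (∀ (u v : Fin n) → Arc O u v → Adj G u v) ×
  (∀ (u v : Fin n) → Adj G u v → Arc O u v ⊎ Arc O v u) ×
  (∀ (u v : Fin n) → Arc O u v → ¬ Arc O v u)

IsTransitiveOrientation : ∀ {n} → Graph n → Orientation n → Set
IsTransitiveOrientation {n} G O =
  IsOrientationOf G O × (∀ (u v w : Fin n) → Arc O u v → Arc O v w → Arc O u w)

Cover : ∀ {n} → Orientation n → Fin n → Fin n → Set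
Cover {n} O u v = Arc O u v × ¬ (∃[ w ] (Arc O u w × Arc O w v))

HasseEdge : ∀ {n} → Orientation n → Fin n → Fin n → Set
HasseEdge O u v = Cover O u v ⊎ Cover O v u

Connected : ∀ {n} → (Fin n → Fin n → Set) → Set
Connected {n} R = ∀ (u v : Fin n) → Star R u v

HasCycle : ∀ {n} → (Fin n → Fin n → Set) → Set
HasCycle {n} R =
  Σ (Fin n) λ x → Σ (List (Fin n)) λ xs →
    (2 ≤ length xs) × Unique (x ∷ xs) × Linked R ((x ∷ xs) ++ (x ∷ []))

IsTree : ∀ {n} → (Fin n → Fin n → Set) → Set
IsTree R = Connected R × ¬ HasCycle R

IsTreelikeOrientation : ∀ {n} → Graph n → Orientation n → Set
IsTreelikeOrientation G O = IsTransitiveOrientation G O × IsTree (HasseEdge O)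

TreelikeComparability : ∀ {n} → Graph n → Set
TreelikeComparability {n} G = Σ (Orientation n) λ O → IsTreelikeOrientation G O

IsRoot : ∀ {n} → Graph n → Fin n → Set
IsRoot {n} G r = ∀ (v : Fin n) → v ≢ r → Adj G r v

DoubleArborescence : ∀ {n} → Graph n → Set
DoubleArborescence {n} G = TreelikeComparability G × ∃[ r ] IsRoot G r

IsSource : ∀ {n} → Orientation n → Fin n → Set
IsSource {n} O r = ∀ (v : Fin n) → ¬ Arc O v r

IsSink : ∀ {n} → Orientation n → Fin n → Set
IsSink {n} O r = ∀ (v : Fin n) → ¬ Arc O r v

Arborescence : ∀ {n} → Graph n → Set
Arborescence {n} G =
  DoubleArborescence G ×
  Σ (Orientation n) λ O → IsTreelikeOrientation G O ×
    ∃[ r ] (IsRoot G r × (IsSource O r ⊎ IsSink O r))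

StrictDoubleArborescence : ∀ {n} → Graph n → Set
StrictDoubleArborescence G = DoubleArborescence G × ¬ Arborescence G

{-# OPTIONS --safe #-}
module Submission where

open import Defs
open import Data.Nat using (ℕ)
open import Data.Fin using (Fin)
open import Data.Fin.Properties using (_≟_; any?)
open import Data.Fin.Induction using (spo-noetherian)
open import Data.Bool using (T)
open import Data.Product using (∃; ∃-syntax; _×_; _,_; proj₁; proj₂)
open import Data.Sum using (_⊎_; inj₁; inj₂; swap)
open import Function using (flip; _∘_)
open import Induction.WellFounded using (Acc; acc)
open import Relation.Binary.Core using (Rel)
open import Relation.Binary.Definitions using (Decidable)
open import Relation.Binary.Structures using (IsStrictPartialOrder)
open import Relation.Binary.PropositionalEquality
  using (_≡_; _≢_; refl; subst; resp₂; isEquivalence)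
open import Relation.Nullary using (¬_; Dec; yes; no; contradiction)
open import Relation.Nullary.Decidable using (T?; ¬?; _×-dec_; decidable-stable)

-- Let r be a root and suppose its out-neighbours are pairwise adjacent. Then
-- every vertex m with r → m is again a root: a vertex below r is below m by
-- transitivity, and a vertex above r is adjacent to m by assumption. Taking m
-- maximal above r (or m = r) gives a root that is a sink, so G would be an
-- arborescence. Reversing all arcs gives the second half.

module _ {n ℓ} {_<_ : Rel (Fin n) ℓ}
         (spo : IsStrictPartialOrder _≡_ _<_) (_<?_ : Decidable _<_) where

  open IsStrictPartialOrder spo using (trans)

  maximal-above : ∀ x → ∃[ m ] ((x ≡ m ⊎ x < m) × ∀ y → ¬ m < y)
  maximal-above x = go x (spo-noetherian spo x)
    where
    go : ∀ x → Acc (flip _<_) x → ∃[ m ] ((x ≡ m ⊎ x < m) × ∀ y → ¬ m < y)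
    go x (acc larger) with any? (x <?_)
    ... | no x-maximal = x , inj₁ refl , λ y x<y → x-maximal (y , x<y)
    ... | yes (y , x<y) with go y (larger x<y)
    ...   | m , inj₁ refl , m-maximal = m , inj₂ x<y , m-maximal
    ...   | m , inj₂ y<m , m-maximal = m , inj₂ (trans x<y y<m) , m-maximal

adj-symmetric : ∀ {n} (G : Graph n) {u v} → Adj G u v → Adj G v u
adj-symmetric G {u} {v} = subst T (adj-sym G u v)

reverse-isTransitiveOrientation : ∀ {n} {G : Graph n} {O : Orientation n} →
  IsTransitiveOrientation G O → IsTransitiveOrientation G (flip O)
reverse-isTransitiveOrientation {G = G} ((arc⇒adj , adj⇒arc , asym) , tr) =
  ( (λ u v → adj-symmetric G ∘ arc⇒adj v u)
  , (λ u v → swap ∘ adj⇒arc u v)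
  , (λ u v → asym v u) )
  , (λ u v w u←v v←w → tr w v u v←w u←v)

NonAdjacentSuccessors : ∀ {n} → Graph n → Orientation n → Fin n → Set
NonAdjacentSuccessors G O r =
  ∃[ a₁ ] ∃[ a₂ ] (a₁ ≢ a₂ × ¬ Adj G a₁ a₂ × Arc O r a₁ × Arc O r a₂)

module _ {n} (G : Graph n) (O : Orientation n)
         (tO : IsTransitiveOrientation G O) where

  private
    arc⇒adj : ∀ u v → Arc O u v → Adj G u v
    arc⇒adj = proj₁ (proj₁ tO)

    adj⇒arc : ∀ u v → Adj G u v → Arc O u v ⊎ Arc O v u
    adj⇒arc = proj₁ (proj₂ (proj₁ tO))

    asym : ∀ u v → Arc O u v → ¬ Arc O v u
    asym = proj₂ (proj₂ (proj₁ tO))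

    arc-trans : ∀ u v w → Arc O u v → Arc O v w → Arc O u w
    arc-trans = proj₂ tO

  arc-isStrictPartialOrder : IsStrictPartialOrder _≡_ (Arc O)
  arc-isStrictPartialOrder = record
    { isEquivalence = isEquivalence
    ; irrefl        = λ { refl u→u → asym _ _ u→u u→u }
    ; trans         = λ {u} {v} {w} → arc-trans u v w
    ; <-resp-≈      = resp₂ (Arc O)
    }

  nonAdjacentSuccessors? : ∀ r → Dec (NonAdjacentSuccessors G O r)
  nonAdjacentSuccessors? r = any? λ a₁ → any? λ a₂ →
    ¬? (a₁ ≟ a₂) ×-dec ¬? (T? (adj G a₁ a₂)) ×-dec T? (O r a₁) ×-dec T? (O r a₂)

  successor-isRoot : ∀ {r m} → IsRoot G r → ¬ NonAdjacentSuccessors G O r →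
                     Arc O r m → IsRoot G m
  successor-isRoot {r} {m} r-root no-pair r→m v v≢m with v ≟ r
  ... | yes refl = adj-symmetric G (arc⇒adj r m r→m)
  ... | no v≢r with adj⇒arc r v (r-root v v≢r)
  ...   | inj₂ v→r = adj-symmetric G (arc⇒adj v m (arc-trans v r m v→r r→m))
  ...   | inj₁ r→v = decidable-stable (T? (adj G m v)) λ m≁v →
            no-pair (v , m , v≢m , m≁v ∘ adj-symmetric G , r→v , r→m)

  no-sink-root⇒nonAdjacentSuccessors :
    ∀ r → IsRoot G r → (∀ m → IsRoot G m → ¬ IsSink O m) → NonAdjacentSuccessors G O r
  no-sink-root⇒nonAdjacentSuccessors r r-root no-sink-root with nonAdjacentSuccessors? r
  ... | yes pair = pair
  ... | no no-pair with maximal-above arc-isStrictPartialOrder (λ u v → T? (O u v)) r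
  ...   | m , inj₁ refl , m-sink = contradiction m-sink (no-sink-root r r-root)
  ...   | m , inj₂ r→m , m-sink =
            contradiction m-sink (no-sink-root m (successor-isRoot r-root no-pair r→m))

strict⇒no-extremal-root : ∀ {n} {G : Graph n} {O : Orientation n} →
  StrictDoubleArborescence G → IsTreelikeOrientation G O →
  ∀ m → IsRoot G m → ¬ (IsSource O m ⊎ IsSink O m)
strict⇒no-extremal-root (da , not-arborescence) tlO m m-root extremal =
  not-arborescence (da , _ , tlO , m , m-root , extremal)

lemma3 : ∀ (n : ℕ) (G : Graph n) (r : Fin n) →
    StrictDoubleArborescence G → IsRoot G r →
    (O : Orientation n) → IsTreelikeOrientation G O →
    (∃[ a₁ ] ∃[ a₂ ] (a₁ ≢ a₂ × ¬ Adj G a₁ a₂ × Arc O r a₁ × Arc O r a₂)) ×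
    (∃[ a₃ ] ∃[ a₄ ] (a₃ ≢ a₄ × ¬ Adj G a₃ a₄ × Arc O a₃ r × Arc O a₄ r))
lemma3 n G r strict r-root O tlO@(tO , _) =
    no-sink-root⇒nonAdjacentSuccessors G O tO r r-root
      (λ m m-root → no-extremal m m-root ∘ inj₂)
  , no-sink-root⇒nonAdjacentSuccessors G (flip O) reversed r r-root
      (λ m m-root → no-extremal m m-root ∘ inj₁)
  where
  no-extremal : ∀ m → IsRoot G m → ¬ (IsSource O m ⊎ IsSink O m)
  no-extremal = strict⇒no-extremal-root {G = G} {O = O} strict tlO

  reversed : IsTransitiveOrientation G (flip O)
  reversed = reverse-isTransitiveOrientation {G = G} {O = O} tO
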